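{- Let $G=(V,E)$ be a finite simple graph with a splitting $(G^1,G^2,X)$. Then \[ D(G,x)=\mathbf u_X(G^1)^T\,\mathbf Q_X\,\mathbf u_X(G^2). \]
   Context: The domination polynomial of a finite simple graph $H=(V,E)$ is $D(H,x)=\sum_{W\subseteq V,\ N_H[W]=V}x^{|W|}$, where $N_H[W]$ is the closed neighborhood of $W$. Splitting: $(G^1,G^2,X)$ is a splitting of $G$ if $G^i=(V^i,E^i)$ are subgraphs of $G$ with $V=V^1\cup V^2$, $X=V^1\cap V^2$, $E=E^1\cup E^2$ and $E^1\cap E^2=\emptyset$. Index set: $R(X)=\{(A,B):A\subseteq B\subseteq X\}$. Vectors $\mathbf u_X(G^i)$: for $(A,B)\in R(X)$ let \[ D(G^i,(A,B),x)=\sum_{W\subseteq V^i}[W\cap X=A]\,[N_{G^i}[W]\cap X=B]\,[N_{G^i}[W]\setminus X=V^i\setminus X]\,x^{|W\setminus X|}, \] where $[\cdot]$ is $1$ if the condition holds and $0$ otherwise. $\mathbf u_X(G^i)$ is the vector indexed by $R(X)$ with these entries. Matrix $\mathbf Q_X$: for a vertex $v$, $\mathbf Q_v$ is the $3\times 3$ matrix indexed by $R(\{v\})$, with rows and columns in the order $(\emptyset,\{v\}),(\emptyset,\emptyset),(\{v\},\{v\})$: \[ \mathbf Q_v=\begin{pmatrix}1&1&0\\1&0&0\\0&0&x\end{pmatrix}. \] $\mathbf Q_X=\bigotimes_{v\in X}\mathbf Q_v$ is the Kronecker product, indexed by $R(X)$ through the identification of $((A_v,B_v))_{v\in X}$ with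 $(\bigcup A_v,\bigcup B_v)$. Its entry at $((A,B),(A',B'))$ is $\prod_{v\in X}\mathbf Q_v[(A\cap\{v\},B\cap\{v\}),(A'\cap\{v\},B'\cap\{v\})]$. -}

module Defs where

open import Level using (Level)
open import Data.Nat as ℕ using (ℕ; zero; suc)
open import Data.Bool using (Bool; true; false; _∧_; _∨_; not; if_then_else_)
import Data.Bool.Properties as BoolP
open import Data.Fin using (Fin)
open import Data.Fin.Subset using (Subset; _∈_; _⊆_; _∩_; _∪_; _─_; ⊤; ∣_∣)
open import Data.Fin.Subset.Properties using (_⊆?_; _∈?_)
open import Data.Vec using (Vec; []; _∷_; lookup; tabulate)
open import Data.Vec.Properties using (≡-dec)
open import Data.List using (List; []; _∷_; _++_; map; filter; foldr; concatMap)
open import Data.List.Properties using ()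
open import Data.Product using (_×_; _,_; proj₁; proj₂)
open import Relation.Nullary using (¬_)
open import Relation.Nullary.Decidable using (⌊_⌋)
open import Relation.Binary.PropositionalEquality using (_≡_)
open import Algebra.Bundles using (CommutativeSemiring)

record Graph (n : ℕ) : Set where
  field
    adj    : Fin n → Fin n → Bool
    sym    : ∀ u v → adj u v ≡ adj v u
    irrefl : ∀ v → adj v v ≡ false
open Graph public

record Subgraph {n : ℕ} (G : Graph n) : Set where
  field
    verts    : Subset n
    sadj     : Fin n → Fin n → Bool
    ssym     : ∀ u v → sadj u v ≡ sadj v u
    sub-edge : ∀ u v → sadj u v ≡ true → adj G u v ≡ true
    sub-vert : ∀ u v → sadj u v ≡ true → u ∈ verts
open Subgraph public

record IsSplitting {n : ℕ} (G : Graph n) (G¹ G² : Subgraph G) (X : Subset n) : Set where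
  field
    vert-union : verts G¹ ∪ verts G² ≡ ⊤
    X-inter    : X ≡ verts G¹ ∩ verts G²
    edge-union : ∀ u v → adj G u v ≡ (sadj G¹ u v ∨ sadj G² u v)
    edge-disj  : ∀ u v → (sadj G¹ u v ∧ sadj G² u v) ≡ false

anyFin : ∀ {n} → (Fin n → Bool) → Bool
anyFin {zero}  f = false
anyFin {suc n} f = f Fin.zero ∨ anyFin (λ i → f (Fin.suc i))

allFin : ∀ {n} → (Fin n → Bool) → Bool
allFin {zero}  f = true
allFin {suc n} f = f Fin.zero ∧ allFin (λ i → f (Fin.suc i))

_=ˢ_ : ∀ {n} → Subset n → Subset n → Bool
A =ˢ B = ⌊ ≡-dec BoolP._≟_ A B ⌋

_⊆ᵇ_ : ∀ {n} → Subset n → Subset n → Bool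
A ⊆ᵇ B = ⌊ A ⊆? B ⌋

mem : ∀ {n} → Fin n → Subset n → Bool
mem v S = lookup S v

allSubsets : ∀ n → List (Subset n)
allSubsets zero    = [] ∷ []
allSubsets (suc n) = map (false ∷_) (allSubsets n) ++ map (true ∷_) (allSubsets n)

closedNbhd : ∀ {n} → (Fin n → Fin n → Bool) → Subset n → Subset n
closedNbhd a W = tabulate (λ v → mem v W ∨ anyFin (λ w → mem w W ∧ a w v))

-- Evaluation of the polynomials in an arbitrary commutative semiring R
-- at an arbitrary element x (equivalent to identity in ℕ[x]).

module Poly {c ℓ : Level} (R : CommutativeSemiring c ℓ) where
  open CommutativeSemiring R

  pow : Carrier → ℕ → Carrier
  pow x zero    = 1#
  pow x (suc k) = x * pow x k

  sumL : List Carrier → Carrier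
  sumL = foldr _+_ 0#

  prodFin : ∀ {n} → (Fin n → Carrier) → Carrier
  prodFin {zero}  f = 1#
  prodFin {suc n} f = f Fin.zero * prodFin (λ i → f (Fin.suc i))

  sumSubsets : ∀ {n} → (Subset n → Bool) → (Subset n → Carrier) → Carrier
  sumSubsets {n} P f = sumL (map f (filter (λ W → P W Data.Bool.≟ true) (allSubsets n)))

  D : ∀ {n} → Graph n → Carrier → Carrier
  D G x = sumSubsets (λ W → closedNbhd (adj G) W =ˢ ⊤) (λ W → pow x ∣ W ∣)

  RX : ∀ {n} → Subset n → List (Subset n × Subset n)
  RX {n} X = filter (λ p → ((proj₁ p ⊆ᵇ proj₂ p) ∧ (proj₂ p ⊆ᵇ X)) Data.Bool.≟ true)
                    (concatMap (λ A → map (A ,_) (allSubsets n)) (allSubsets n))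

  uX : ∀ {n} {G : Graph n} → Subset n → Subgraph G → Subset n × Subset n → Carrier → Carrier
  uX X H (A , B) x =
    sumSubsets
      (λ W → (W ⊆ᵇ verts H)
           ∧ ((W ∩ X) =ˢ A)
           ∧ ((closedNbhd (sadj H) W ∩ X) =ˢ B)
           ∧ ((closedNbhd (sadj H) W ─ X) =ˢ (verts H ─ X)))
      (λ W → pow x ∣ W ─ X ∣)

  -- Q_v, indexed by R({v}) in the order (∅,{v}), (∅,∅), ({v},{v});
  -- an index is given by (v ∈ A, v ∈ B).
  Qv : Carrier → Bool × Bool → Bool × Bool → Carrier
  Qv x (false , true)  (false , true)  = 1#
  Qv x (false , true)  (false , false) = 1#
  Qv x (false , false) (false , true)  = 1#
  Qv x (true  , true)  (true  , true)  = x
  Qv x _               _               = 0#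

  -- Entry of Q_X = ⊗_{v ∈ X} Q_v at ((A,B),(A',B')).
  QX : ∀ {n} → Subset n → Carrier → Subset n × Subset n → Subset n × Subset n → Carrier
  QX X x (A , B) (A' , B') =
    prodFin (λ v → if mem v X then Qv x (mem v A , mem v B) (mem v A' , mem v B') else 1#)

  bilinear : ∀ {n} → Subset n
           → (Subset n × Subset n → Carrier)
           → (Subset n × Subset n → Subset n × Subset n → Carrier)
           → (Subset n × Subset n → Carrier) → Carrier
  bilinear X u Q w = sumL (map (λ p → sumL (map (λ q → u p * (Q p q * w q)) (RX X))) (RX X))

-- Both sides are rewritten as double sums over pairs (W₁, W₂) of vertex sets
-- and compared term by term.
--  * W ↦ (W ∩ V¹, W ∩ V²) is a bijection onto the compatible pairs (W₁ ⊆ V¹,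
--    W₂ ⊆ V², W₁ ∩ X = W₂ ∩ X) with inverse W₁ ∪ W₂, which reindexes D(G, x).
--  * u_X(H)(A, B) sums over the W recording (A, B) = (W ∩ X, N_H[W] ∩ X), so the
--    sum over R(X) in the bilinear form collapses onto these indices.
--  * Each summand is a product over the vertices of monomials 0 or x^k.  For a
--    compatible pair N_G[W₁ ∪ W₂] = N_{G¹}[W₁] ∪ N_{G²}[W₂] and the factors agree
--    vertex by vertex; an incompatible pair contributes 0 to both sides.
module Submission where

open import Defs hiding (sym)
open import Level using (Level)
open import Function using (_∘_)
open import Function.Bundles using (Equivalence)
open import Data.Nat using (ℕ; zero; suc; _≡ᵇ_) renaming (_+_ to _+ℕ_)
open import Data.Nat.Properties using (≡ᵇ⇒≡)
open import Data.Fin using (Fin) renaming (zero to fzero; suc to fsuc)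
open import Data.Fin.Subset using (Subset; _∩_; _∪_; _─_; ⊤; ∣_∣)
import Data.Fin.Subset.Properties as SubsetP
open import Data.Bool using (Bool; true; false; _∧_; _∨_; not; if_then_else_)
open import Data.Bool.Properties
  using (∧-zeroʳ; ∧-identityʳ; ∧-conicalˡ; ∧-conicalʳ; ∧-commutativeMonoid; ∨-commutativeMonoid; T-≡)
import Data.Bool as Bool
open import Data.Vec using (Vec; []; _∷_)
import Data.Vec.Properties as VecP
open import Data.List using (List; []; _∷_; _++_; map; filter; concatMap)
open import Data.Product using (_×_; _,_; proj₁; proj₂; ∃)
open import Relation.Nullary.Decidable using (does; toWitness; isYes≗does)
open import Relation.Binary.PropositionalEquality
  using (_≡_; refl; sym; trans; cong; cong₂; subst; subst₂; module ≡-Reasoning)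
open import Algebra.Bundles using (CommutativeSemiring; CommutativeMonoid)
import Algebra.Properties.CommutativeSemigroup as CommSemigroupProps
import Relation.Binary.Reasoning.Setoid as SetoidReasoning

_==_ : Bool → Bool → Bool
a == b = does (a Bool.≟ b)

_⇒_ : Bool → Bool → Bool
a ⇒ b = not a ∨ b

infix 5 _==_
infixr 4 _⇒_

==-sound : ∀ {a b} → (a == b) ≡ true → a ≡ b
==-sound {false} {false} _  = refl
==-sound {true}  {true}  _  = refl
==-sound {false} {true}  ()
==-sound {true}  {false} ()

⇒-elim : ∀ {a b} → (a ⇒ b) ≡ true → a ≡ true → b ≡ true
⇒-elim e refl = e

⇒-intro : ∀ {a b} → (a ≡ true → b ≡ true) → (a ⇒ b) ≡ true
⇒-intro {false} _ = refl
⇒-intro {true}  f = f refl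

==-complete : ∀ {a b} → a ≡ b → (a == b) ≡ true
==-complete {false} refl = refl
==-complete {true}  refl = refl

∧-mono-⇒ : ∀ {a b} c → (a ⇒ b) ≡ true → ((a ∧ c) ⇒ (b ∧ c)) ≡ true
∧-mono-⇒ {false}        c     _  = refl
∧-mono-⇒ {true} {true}  false _  = refl
∧-mono-⇒ {true} {true}  true  _  = refl
∧-mono-⇒ {true} {false} c     ()

∧-⇒ʳ : ∀ a b → ((a ∧ b) ⇒ b) ≡ true
∧-⇒ʳ false b     = refl
∧-⇒ʳ true  false = refl
∧-⇒ʳ true  true  = refl

-- Every finite
-- case analysis on vertex-local bits below is discharged this way, by 'refl'.
tautology : ∀ k → (Vec Bool k → Bool) → Bool
tautology zero    φ = φ []
tautology (suc k) φ = tautology k (φ ∘ (true ∷_)) ∧ tautology k (φ ∘ (false ∷_))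

tautology-sound : ∀ k (φ : Vec Bool k → Bool) → tautology k φ ≡ true → ∀ bs → φ bs ≡ true
tautology-sound zero    φ t []           = t
tautology-sound (suc k) φ t (true ∷ bs)  = tautology-sound k _ (∧-conicalˡ _ _ t) bs
tautology-sound (suc k) φ t (false ∷ bs) = tautology-sound k _ (∧-conicalʳ _ _ t) bs

module ∧-Props = CommSemigroupProps (CommutativeMonoid.commutativeSemigroup ∧-commutativeMonoid)
module ∨-Props = CommSemigroupProps (CommutativeMonoid.commutativeSemigroup ∨-commutativeMonoid)

allFin-∧ : ∀ {n} (p q : Fin n → Bool) → (allFin p ∧ allFin q) ≡ allFin (λ v → p v ∧ q v)
allFin-∧ {zero}  p q = refl
allFin-∧ {suc n} p q =
  trans (∧-Props.interchange (p fzero) _ (q fzero) _)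
        (cong ((p fzero ∧ q fzero) ∧_) (allFin-∧ (p ∘ fsuc) (q ∘ fsuc)))

allFin-∧₃ : ∀ {n} (p q r : Fin n → Bool) →
            (allFin p ∧ (allFin q ∧ allFin r)) ≡ allFin (λ v → p v ∧ (q v ∧ r v))
allFin-∧₃ p q r = trans (cong (allFin p ∧_) (allFin-∧ q r)) (allFin-∧ p _)

anyFin-∨ : ∀ {n} (p q : Fin n → Bool) → anyFin (λ v → p v ∨ q v) ≡ (anyFin p ∨ anyFin q)
anyFin-∨ {zero}  p q = refl
anyFin-∨ {suc n} p q =
  trans (cong ((p fzero ∨ q fzero) ∨_) (anyFin-∨ (p ∘ fsuc) (q ∘ fsuc)))
        (∨-Props.interchange (p fzero) (q fzero) _ _)

allFin-cong : ∀ {n} {p q : Fin n → Bool} → (∀ v → p v ≡ q v) → allFin p ≡ allFin q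
allFin-cong {zero}  h = refl
allFin-cong {suc n} h = cong₂ _∧_ (h fzero) (allFin-cong (h ∘ fsuc))

anyFin-cong : ∀ {n} {p q : Fin n → Bool} → (∀ v → p v ≡ q v) → anyFin p ≡ anyFin q
anyFin-cong {zero}  h = refl
anyFin-cong {suc n} h = cong₂ _∨_ (h fzero) (anyFin-cong (h ∘ fsuc))

allFin-intro : ∀ {n} (p : Fin n → Bool) → (∀ v → p v ≡ true) → allFin p ≡ true
allFin-intro {zero}  p h = refl
allFin-intro {suc n} p h = cong₂ _∧_ (h fzero) (allFin-intro (p ∘ fsuc) (h ∘ fsuc))

allFin-elim : ∀ {n} (p : Fin n → Bool) → allFin p ≡ true → ∀ v → p v ≡ true
allFin-elim p e fzero    = ∧-conicalˡ _ _ e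
allFin-elim p e (fsuc v) = allFin-elim (p ∘ fsuc) (∧-conicalʳ _ _ e) v

allFin-false : ∀ {n} (p : Fin n → Bool) → allFin p ≡ false → ∃ λ v → p v ≡ false
allFin-false {suc n} p e with p fzero in e₀
... | false = fzero , e₀
... | true with allFin-false (p ∘ fsuc) e
...   | v , eᵥ = fsuc v , eᵥ

anyFin-true : ∀ {n} (p : Fin n → Bool) → anyFin p ≡ true → ∃ λ v → p v ≡ true
anyFin-true {suc n} p e with p fzero in e₀
... | true = fzero , e₀
... | false with anyFin-true (p ∘ fsuc) e
...   | v , eᵥ = fsuc v , eᵥ

mem-∩ : ∀ {n} (v : Fin n) A B → mem v (A ∩ B) ≡ (mem v A ∧ mem v B)
mem-∩ v A B = VecP.lookup-zipWith _∧_ v A B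

mem-∪ : ∀ {n} (v : Fin n) A B → mem v (A ∪ B) ≡ (mem v A ∨ mem v B)
mem-∪ v A B = VecP.lookup-zipWith _∨_ v A B

mem-─ : ∀ {n} (v : Fin n) (A B : Subset n) → mem v (A ─ B) ≡ (mem v A ∧ not (mem v B))
mem-─ fzero    (a ∷ A) (true  ∷ B) = sym (∧-zeroʳ a)
mem-─ fzero    (a ∷ A) (false ∷ B) = sym (∧-identityʳ a)
mem-─ (fsuc v) (_ ∷ A) (_     ∷ B) = mem-─ v A B

mem-⊤ : ∀ {n} (v : Fin n) → mem v ⊤ ≡ true
mem-⊤ v = VecP.lookup-replicate v true

mem-N : ∀ {n} (a : Fin n → Fin n → Bool) (W : Subset n) (v : Fin n) →
        mem v (closedNbhd a W) ≡ (mem v W ∨ anyFin (λ u → mem u W ∧ a u v))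
mem-N a W v = VecP.lookup∘tabulate _ v

=ˢ-cons : ∀ {n} b c (A B : Subset n) → ((b ∷ A) =ˢ (c ∷ B)) ≡ ((b == c) ∧ (A =ˢ B))
=ˢ-cons b c A B = trans (isYes≗does (VecP.≡-dec Bool._≟_ (b ∷ A) (c ∷ B)))
                        (cong ((b == c) ∧_) (sym (isYes≗does (VecP.≡-dec Bool._≟_ A B))))

=ˢ-sound : ∀ {n} {A B : Subset n} → (A =ˢ B) ≡ true → A ≡ B
=ˢ-sound e = toWitness (Equivalence.from T-≡ e)

=ˢ-pointwise : ∀ {n} (A B : Subset n) → (A =ˢ B) ≡ allFin (λ v → mem v A == mem v B)
=ˢ-pointwise A B = trans (isYes≗does (VecP.≡-dec Bool._≟_ A B)) (go A B)
  where
  go : ∀ {n} (A B : Subset n) → does (VecP.≡-dec Bool._≟_ A B) ≡ allFin (λ v → mem v A == mem v B)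
  go []      []      = refl
  go (a ∷ A) (b ∷ B) = cong ((a == b) ∧_) (go A B)

=ˢ⊤-pointwise : ∀ {n} (A : Subset n) → (A =ˢ ⊤) ≡ allFin (λ v → mem v A)
=ˢ⊤-pointwise A = trans (=ˢ-pointwise A ⊤) (allFin-cong (λ v → ==-true (mem v A) (mem-⊤ v)))
  where
  ==-true : ∀ a {t} → t ≡ true → (a == t) ≡ a
  ==-true false refl = refl
  ==-true true  refl = refl

⊆ᵇ-pointwise : ∀ {n} (A B : Subset n) → (A ⊆ᵇ B) ≡ allFin (λ v → mem v A ⇒ mem v B)
⊆ᵇ-pointwise A B = trans (isYes≗does (A SubsetP.⊆? B)) (go A B)
  where
  go : ∀ {n} (A B : Subset n) → does (A SubsetP.⊆? B) ≡ allFin (λ v → mem v A ⇒ mem v B)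
  go []          []          = refl
  go (false ∷ A) (_     ∷ B) = go A B
  go (true  ∷ A) (false ∷ B) = refl
  go (true  ∷ A) (true  ∷ B) = go A B

⊆ᵇ-intro : ∀ {n} (A B : Subset n) → (∀ v → (mem v A ⇒ mem v B) ≡ true) → (A ⊆ᵇ B) ≡ true
⊆ᵇ-intro A B h = trans (⊆ᵇ-pointwise A B) (allFin-intro _ h)

-- At a vertex v the relevant bits are: w₁, w₂ (v ∈ W₁, W₂), a₁, a₂
-- (v ∈ V¹, V²), ξ (v ∈ X) and ν₁, ν₂ (v ∈ N_{G¹}[W₁], N_{G²}[W₂]).

splitᵥ : (a₁ a₂ ξ : Bool) → Bool
splitᵥ a₁ a₂ ξ = (a₁ ∨ a₂) ∧ (ξ == (a₁ ∧ a₂))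

-- W₁ ⊆ V¹, W₂ ⊆ V² and W₁ ∩ X = W₂ ∩ X: exactly the pairs (W ∩ V¹, W ∩ V²).
compatible : ∀ {n} (V₁ V₂ X W₁ W₂ : Subset n) → Bool
compatible V₁ V₂ X W₁ W₂ = (W₁ ⊆ᵇ V₁) ∧ ((W₂ ⊆ᵇ V₂) ∧ ((W₁ ∩ X) =ˢ (W₂ ∩ X)))

compatibleᵥ : (w₁ w₂ a₁ a₂ ξ : Bool) → Bool
compatibleᵥ w₁ w₂ a₁ a₂ ξ = (w₁ ⇒ a₁) ∧ ((w₂ ⇒ a₂) ∧ ((w₁ ∧ ξ) == (w₂ ∧ ξ)))

compatible-pointwise : ∀ {n} (V₁ V₂ X W₁ W₂ : Subset n) → compatible V₁ V₂ X W₁ W₂ ≡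
  allFin (λ v → compatibleᵥ (mem v W₁) (mem v W₂) (mem v V₁) (mem v V₂) (mem v X))
compatible-pointwise V₁ V₂ X W₁ W₂ =
  trans (cong₂ _∧_ (⊆ᵇ-pointwise W₁ V₁) (cong₂ _∧_ (⊆ᵇ-pointwise W₂ V₂) (=ˢ-pointwise _ _)))
        (trans (allFin-∧₃ (λ v → mem v W₁ ⇒ mem v V₁) (λ v → mem v W₂ ⇒ mem v V₂)
                                   (λ v → mem v (W₁ ∩ X) == mem v (W₂ ∩ X)))
               (allFin-cong traces))
  where
  traces : ∀ v → ((mem v W₁ ⇒ mem v V₁) ∧ ((mem v W₂ ⇒ mem v V₂) ∧ (mem v (W₁ ∩ X) == mem v (W₂ ∩ X))))
               ≡ compatibleᵥ (mem v W₁) (mem v W₂) (mem v V₁) (mem v V₂) (mem v X)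
  traces v = cong (λ e → (mem v W₁ ⇒ mem v V₁) ∧ ((mem v W₂ ⇒ mem v V₂) ∧ e))
                  (cong₂ _==_ (mem-∩ v W₁ X) (mem-∩ v W₂ X))

-- W ⊆ V and the neighbourhood N agrees with V outside X: the condition on
-- W in the entries of u_X(H), for V = V(H) and N = N_H[W].
coversOutside : ∀ {n} (X V N W : Subset n) → Bool
coversOutside X V N W = (W ⊆ᵇ V) ∧ ((N ─ X) =ˢ (V ─ X))

coversOutsideᵥ : (w a ν ξ : Bool) → Bool
coversOutsideᵥ w a ν ξ = (w ⇒ a) ∧ ((ν ∧ not ξ) == (a ∧ not ξ))

coversOutside-pointwise : ∀ {n} (X V N W : Subset n) → coversOutside X V N W ≡
  allFin (λ v → coversOutsideᵥ (mem v W) (mem v V) (mem v N) (mem v X))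
coversOutside-pointwise X V N W =
  trans (cong₂ _∧_ (⊆ᵇ-pointwise W V) (=ˢ-pointwise _ _))
        (trans (allFin-∧ (λ v → mem v W ⇒ mem v V) (λ v → mem v (N ─ X) == mem v (V ─ X)))
               (allFin-cong outside))
  where
  outside : ∀ v → ((mem v W ⇒ mem v V) ∧ (mem v (N ─ X) == mem v (V ─ X)))
                ≡ coversOutsideᵥ (mem v W) (mem v V) (mem v N) (mem v X)
  outside v = cong ((mem v W ⇒ mem v V) ∧_) (cong₂ _==_ (mem-─ v N X) (mem-─ v V X))

-- Every vertex factor of either side is 0 or a power x^k of x.  Computing
-- with these monomials symbolically (Mono) gives them decidable equality, so
-- the vertex identities below are checked by evaluation.
data Mono : Set where
  0ₘ  : Mono
  x^_ : ℕ → Mono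

infix  9 x^_
infixr 7 _·ₘ_
infix  4 _==ₘ_

_·ₘ_ : Mono → Mono → Mono
0ₘ   ·ₘ _    = 0ₘ
x^ i ·ₘ 0ₘ   = 0ₘ
x^ i ·ₘ x^ j = x^ (i +ℕ j)

_==ₘ_ : Mono → Mono → Bool
0ₘ   ==ₘ 0ₘ   = true
x^ i ==ₘ x^ j = i ≡ᵇ j
_    ==ₘ _    = false

==ₘ-sound : ∀ m m' → (m ==ₘ m') ≡ true → m ≡ m'
==ₘ-sound 0ₘ     0ₘ     _ = refl
==ₘ-sound (x^ i) (x^ j) e = cong x^_ (≡ᵇ⇒≡ i j (Equivalence.from T-≡ e))
==ₘ-sound 0ₘ     (x^ _) ()
==ₘ-sound (x^ _) 0ₘ     ()

[_]ₘ : Bool → Mono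
[ b ]ₘ = if b then x^ 0 else 0ₘ

xᵇ : Bool → Mono
xᵇ b = if b then x^ 1 else x^ 0

Qᵥₘ : Bool × Bool → Bool × Bool → Mono
Qᵥₘ (false , true)  (false , true)  = x^ 0
Qᵥₘ (false , true)  (false , false) = x^ 0
Qᵥₘ (false , false) (false , true)  = x^ 0
Qᵥₘ (true  , true)  (true  , true)  = x^ 1
Qᵥₘ _               _               = 0ₘ

-- The factor of Q_X(σ₁ W₁, σ₂ W₂) at v (trivial outside X).
Qₘ : (w₁ w₂ ξ ν₁ ν₂ : Bool) → Mono
Qₘ w₁ w₂ ξ ν₁ ν₂ = if ξ then Qᵥₘ (w₁ ∧ ξ , ν₁ ∧ ξ) (w₂ ∧ ξ , ν₂ ∧ ξ) else x^ 0

-- The factor at v of  [N_G[W₁ ∪ W₂] = V] · x^|W₁ ∪ W₂|,  with d = [v ∈ N_G[W₁ ∪ W₂]].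
dominationₘ : (w₁ w₂ d : Bool) → Mono
dominationₘ w₁ w₂ d = [ d ]ₘ ·ₘ xᵇ (w₁ ∨ w₂)

-- The factor at v of the summand of u_X(G¹)ᵀ Q_X u_X(G²) belonging to (W₁, W₂).
splittingₘ : (w₁ w₂ a₁ a₂ ξ ν₁ ν₂ : Bool) → Mono
splittingₘ w₁ w₂ a₁ a₂ ξ ν₁ ν₂ =
  ([ coversOutsideᵥ w₁ a₁ ν₁ ξ ]ₘ ·ₘ xᵇ (w₁ ∧ not ξ)) ·ₘ
  (([ coversOutsideᵥ w₂ a₂ ν₂ ξ ]ₘ ·ₘ xᵇ (w₂ ∧ not ξ)) ·ₘ Qₘ w₁ w₂ ξ ν₁ ν₂)

vertex-identity : ∀ w₁ w₂ a₁ a₂ ξ ν₁ ν₂ →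
  splitᵥ a₁ a₂ ξ ≡ true → compatibleᵥ w₁ w₂ a₁ a₂ ξ ≡ true →
  (ν₁ ⇒ a₁) ≡ true → (ν₂ ⇒ a₂) ≡ true → (w₁ ⇒ ν₁) ≡ true → (w₂ ⇒ ν₂) ≡ true →
  dominationₘ w₁ w₂ (ν₁ ∨ ν₂) ≡ splittingₘ w₁ w₂ a₁ a₂ ξ ν₁ ν₂
vertex-identity w₁ w₂ a₁ a₂ ξ ν₁ ν₂ s c n₁ n₂ c₁ c₂ =
  ==ₘ-sound _ _ (⇒-elim (⇒-elim (⇒-elim (⇒-elim (⇒-elim (⇒-elim
    (tautology-sound 7 φ refl (w₁ ∷ w₂ ∷ a₁ ∷ a₂ ∷ ξ ∷ ν₁ ∷ ν₂ ∷ [])) s) c) n₁) n₂) c₁) c₂)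
  where
  φ : Vec Bool 7 → Bool
  φ (w₁ ∷ w₂ ∷ a₁ ∷ a₂ ∷ ξ ∷ ν₁ ∷ ν₂ ∷ []) =
    splitᵥ a₁ a₂ ξ ⇒ compatibleᵥ w₁ w₂ a₁ a₂ ξ ⇒ (ν₁ ⇒ a₁) ⇒ (ν₂ ⇒ a₂) ⇒ (w₁ ⇒ ν₁) ⇒ (w₂ ⇒ ν₂) ⇒
    (dominationₘ w₁ w₂ (ν₁ ∨ ν₂) ==ₘ splittingₘ w₁ w₂ a₁ a₂ ξ ν₁ ν₂)

vertex-zero : ∀ w₁ w₂ a₁ a₂ ξ ν₁ ν₂ →
  compatibleᵥ w₁ w₂ a₁ a₂ ξ ≡ false → splittingₘ w₁ w₂ a₁ a₂ ξ ν₁ ν₂ ≡ 0ₘ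
vertex-zero w₁ w₂ a₁ a₂ ξ ν₁ ν₂ c =
  ==ₘ-sound _ _ (⇒-elim (tautology-sound 7 φ refl (w₁ ∷ w₂ ∷ a₁ ∷ a₂ ∷ ξ ∷ ν₁ ∷ ν₂ ∷ [])) (cong not c))
  where
  φ : Vec Bool 7 → Bool
  φ (w₁ ∷ w₂ ∷ a₁ ∷ a₂ ∷ ξ ∷ ν₁ ∷ ν₂ ∷ []) =
    not (compatibleᵥ w₁ w₂ a₁ a₂ ξ) ⇒ (splittingₘ w₁ w₂ a₁ a₂ ξ ν₁ ν₂ ==ₘ 0ₘ)

edge-split : ∀ w₁ w₂ a₁ a₂ ξ e₁ e₂ →
  splitᵥ a₁ a₂ ξ ≡ true → compatibleᵥ w₁ w₂ a₁ a₂ ξ ≡ true → (e₁ ⇒ a₁) ≡ true → (e₂ ⇒ a₂) ≡ true →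
  ((w₁ ∨ w₂) ∧ (e₁ ∨ e₂)) ≡ ((w₁ ∧ e₁) ∨ (w₂ ∧ e₂))
edge-split w₁ w₂ a₁ a₂ ξ e₁ e₂ s c h₁ h₂ =
  ==-sound (⇒-elim (⇒-elim (⇒-elim (⇒-elim
    (tautology-sound 7 φ refl (w₁ ∷ w₂ ∷ a₁ ∷ a₂ ∷ ξ ∷ e₁ ∷ e₂ ∷ [])) s) c) h₁) h₂)
  where
  φ : Vec Bool 7 → Bool
  φ (w₁ ∷ w₂ ∷ a₁ ∷ a₂ ∷ ξ ∷ e₁ ∷ e₂ ∷ []) =
    splitᵥ a₁ a₂ ξ ⇒ compatibleᵥ w₁ w₂ a₁ a₂ ξ ⇒ (e₁ ⇒ a₁) ⇒ (e₂ ⇒ a₂) ⇒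
    (((w₁ ∨ w₂) ∧ (e₁ ∨ e₂)) == ((w₁ ∧ e₁) ∨ (w₂ ∧ e₂)))

-- W ↦ (W ∩ V¹, W ∩ V²) is a bijection onto the compatible pairs, with
-- inverse (W₁, W₂) ↦ W₁ ∪ W₂.
reindexᵥ : ∀ w w₁ w₂ a₁ a₂ ξ → splitᵥ a₁ a₂ ξ ≡ true →
  (((w ∧ a₁) == w₁) ∧ ((w ∧ a₂) == w₂)) ≡ (((w₁ ∨ w₂) == w) ∧ compatibleᵥ w₁ w₂ a₁ a₂ ξ)
reindexᵥ w w₁ w₂ a₁ a₂ ξ s =
  ==-sound (⇒-elim (tautology-sound 6 φ refl (w ∷ w₁ ∷ w₂ ∷ a₁ ∷ a₂ ∷ ξ ∷ [])) s)
  where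
  φ : Vec Bool 6 → Bool
  φ (w ∷ w₁ ∷ w₂ ∷ a₁ ∷ a₂ ∷ ξ ∷ []) =
    splitᵥ a₁ a₂ ξ ⇒
    ((((w ∧ a₁) == w₁) ∧ ((w ∧ a₂) == w₂)) == (((w₁ ∨ w₂) == w) ∧ compatibleᵥ w₁ w₂ a₁ a₂ ξ))

-- A conjunct implied by two others may be dropped (used to see that the
-- filter defining R(X) is automatic for the index recorded by W).
implied-conjunct : ∀ r p a b q → (a ⇒ b ⇒ r) ≡ true →
  (r ∧ (p ∧ (a ∧ (b ∧ q)))) ≡ (a ∧ (b ∧ (p ∧ q)))
implied-conjunct r p a b q h =
  ==-sound (⇒-elim (tautology-sound 5 φ refl (r ∷ p ∷ a ∷ b ∷ q ∷ [])) h)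
  where
  φ : Vec Bool 5 → Bool
  φ (r ∷ p ∷ a ∷ b ∷ q ∷ []) = (a ⇒ b ⇒ r) ⇒ ((r ∧ (p ∧ (a ∧ (b ∧ q)))) == (a ∧ (b ∧ (p ∧ q))))

nbhd-contains : ∀ {n} (a : Fin n → Fin n → Bool) W v → (mem v W ⇒ mem v (closedNbhd a W)) ≡ true
nbhd-contains a W v =
  ⇒-intro (λ e → trans (mem-N a W v) (cong (_∨ anyFin (λ u → mem u W ∧ a u v)) e))

inR : ∀ {n} → Subset n → Subset n × Subset n → Bool
inR X p = (proj₁ p ⊆ᵇ proj₂ p) ∧ (proj₂ p ⊆ᵇ X)

module _ {n : ℕ} {G : Graph n} where

  nbhd : Subgraph G → Subset n → Subset n
  nbhd H = closedNbhd (sadj H)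

  edge-end : ∀ (H : Subgraph G) u v → (sadj H u v ⇒ mem u (verts H)) ≡ true
  edge-end H u v = ⇒-intro (λ e → VecP.[]=⇒lookup (sub-vert H u v e))

  nbhd-within : ∀ (H : Subgraph G) W → (∀ u → (mem u W ⇒ mem u (verts H)) ≡ true) →
                ∀ v → (mem v (nbhd H W) ⇒ mem v (verts H)) ≡ true
  nbhd-within H W W⊆V v = ⇒-intro (λ e → within (trans (sym (mem-N (sadj H) W v)) e))
    where
    within : (mem v W ∨ anyFin (λ u → mem u W ∧ sadj H u v)) ≡ true → mem v (verts H) ≡ true
    within e with mem v W in eW
    ... | true  = ⇒-elim (W⊆V v) eW
    ... | false with anyFin-true _ e
    ...   | u , eu = ⇒-elim (edge-end H v u) (trans (ssym H v u) (∧-conicalʳ _ _ eu))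

  -- The index of R(X) to which W contributes in u_X(H): (W ∩ X, N_H[W] ∩ X).
  signature : Subset n → Subgraph G → Subset n → Subset n × Subset n
  signature X H W = (W ∩ X , nbhd H W ∩ X)

  signature-inR : ∀ X H W → inR X (signature X H W) ≡ true
  signature-inR X H W =
    cong₂ _∧_ (⊆ᵇ-intro (W ∩ X) (nbhd H W ∩ X) trace-⊆) (⊆ᵇ-intro (nbhd H W ∩ X) X trace-⊆X)
    where
    trace-⊆ : ∀ v → (mem v (W ∩ X) ⇒ mem v (nbhd H W ∩ X)) ≡ true
    trace-⊆ v = subst₂ (λ s t → (s ⇒ t) ≡ true) (sym (mem-∩ v W X)) (sym (mem-∩ v (nbhd H W) X))
                       (∧-mono-⇒ {mem v W} (mem v X) (nbhd-contains (sadj H) W v))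
    trace-⊆X : ∀ v → (mem v (nbhd H W ∩ X) ⇒ mem v X) ≡ true
    trace-⊆X v = subst (λ s → (s ⇒ mem v X) ≡ true) (sym (mem-∩ v (nbhd H W) X))
                       (∧-⇒ʳ (mem v (nbhd H W)) (mem v X))

  selects : Subset n → Subgraph G → Subset n × Subset n → Subset n → Bool
  selects X H (A , B) W = (W ⊆ᵇ verts H) ∧ ((W ∩ X) =ˢ A) ∧ ((nbhd H W ∩ X) =ˢ B)
                          ∧ ((nbhd H W ─ X) =ˢ (verts H ─ X))

  selects-inR : ∀ X H A B W → (inR X (A , B) ∧ selects X H (A , B) W) ≡
    (((W ∩ X) =ˢ A) ∧ (((nbhd H W ∩ X) =ˢ B) ∧ coversOutside X (verts H) (nbhd H W) W))
  selects-inR X H A B W =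
    implied-conjunct (inR X (A , B)) (W ⊆ᵇ verts H) ((W ∩ X) =ˢ A) ((nbhd H W ∩ X) =ˢ B)
                     ((nbhd H W ─ X) =ˢ (verts H ─ X))
    (⇒-intro {(W ∩ X) =ˢ A} λ eA → ⇒-intro {(nbhd H W ∩ X) =ˢ B} λ eB →
      subst₂ (λ A' B' → inR X (A' , B') ≡ true) (=ˢ-sound eA) (=ˢ-sound eB) (signature-inR X H W))

module Splitting {n : ℕ} {G : Graph n} {G¹ G² : Subgraph G} {X : Subset n}
                 (sp : IsSplitting G G¹ G² X) where
  open IsSplitting sp

  V₁ V₂ : Subset n
  V₁ = verts G¹
  V₂ = verts G²

  split-at : ∀ v → splitᵥ (mem v V₁) (mem v V₂) (mem v X) ≡ true
  split-at v = cong₂ _∧_ covered (==-complete (trans (cong (mem v) X-inter) (mem-∩ v V₁ V₂)))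
    where
    covered : (mem v V₁ ∨ mem v V₂) ≡ true
    covered = trans (sym (mem-∪ v V₁ V₂)) (trans (cong (mem v) vert-union) (mem-⊤ v))

  reindex-bool : ∀ W W₁ W₂ → (((W ∩ V₁) =ˢ W₁) ∧ ((W ∩ V₂) =ˢ W₂)) ≡
                             (((W₁ ∪ W₂) =ˢ W) ∧ compatible V₁ V₂ X W₁ W₂)
  reindex-bool W W₁ W₂ = begin
    ((W ∩ V₁) =ˢ W₁) ∧ ((W ∩ V₂) =ˢ W₂)
      ≡⟨ cong₂ _∧_ (=ˢ-pointwise (W ∩ V₁) W₁) (=ˢ-pointwise (W ∩ V₂) W₂) ⟩
    allFin trace₁ ∧ allFin trace₂
      ≡⟨ allFin-∧ trace₁ trace₂ ⟩
    allFin (λ v → trace₁ v ∧ trace₂ v)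
      ≡⟨ allFin-cong at ⟩
    allFin (λ v → union v ∧ compat v)
      ≡⟨ sym (allFin-∧ union compat) ⟩
    allFin union ∧ allFin compat
      ≡⟨ sym (cong₂ _∧_ (=ˢ-pointwise (W₁ ∪ W₂) W) (compatible-pointwise V₁ V₂ X W₁ W₂)) ⟩
    ((W₁ ∪ W₂) =ˢ W) ∧ compatible V₁ V₂ X W₁ W₂ ∎
    where
    open ≡-Reasoning
    trace₁ trace₂ union compat : Fin n → Bool
    trace₁ v = mem v (W ∩ V₁) == mem v W₁
    trace₂ v = mem v (W ∩ V₂) == mem v W₂
    union  v = mem v (W₁ ∪ W₂) == mem v W
    compat v = compatibleᵥ (mem v W₁) (mem v W₂) (mem v V₁) (mem v V₂) (mem v X)
    at : ∀ v → (trace₁ v ∧ trace₂ v) ≡ (union v ∧ compat v)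
    at v = begin
      trace₁ v ∧ trace₂ v
        ≡⟨ cong₂ (λ s t → (s == mem v W₁) ∧ (t == mem v W₂)) (mem-∩ v W V₁) (mem-∩ v W V₂) ⟩
      ((mem v W ∧ mem v V₁) == mem v W₁) ∧ ((mem v W ∧ mem v V₂) == mem v W₂)
        ≡⟨ reindexᵥ (mem v W) (mem v W₁) (mem v W₂) (mem v V₁) (mem v V₂) (mem v X) (split-at v) ⟩
      ((mem v W₁ ∨ mem v W₂) == mem v W) ∧ compat v
        ≡⟨ cong (λ s → (s == mem v W) ∧ compat v) (sym (mem-∪ v W₁ W₂)) ⟩
      union v ∧ compat v ∎

  Compatible : Subset n → Subset n → Set
  Compatible W₁ W₂ = ∀ u → compatibleᵥ (mem u W₁) (mem u W₂) (mem u V₁) (mem u V₂) (mem u X) ≡ true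

  W₁⊆V₁ : ∀ {W₁ W₂} → Compatible W₁ W₂ → ∀ u → (mem u W₁ ⇒ mem u V₁) ≡ true
  W₁⊆V₁ c u = ∧-conicalˡ _ _ (c u)

  W₂⊆V₂ : ∀ {W₁ W₂} → Compatible W₁ W₂ → ∀ u → (mem u W₂ ⇒ mem u V₂) ≡ true
  W₂⊆V₂ {W₁} c u = ∧-conicalˡ _ _ (∧-conicalʳ (mem u W₁ ⇒ mem u V₁) _ (c u))

  nbhd-union : ∀ {W₁ W₂} → Compatible W₁ W₂ → ∀ v →
    mem v (closedNbhd (adj G) (W₁ ∪ W₂)) ≡ (mem v (nbhd G¹ W₁) ∨ mem v (nbhd G² W₂))
  nbhd-union {W₁} {W₂} c v = begin
    mem v (closedNbhd (adj G) (W₁ ∪ W₂))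
      ≡⟨ mem-N (adj G) (W₁ ∪ W₂) v ⟩
    mem v (W₁ ∪ W₂) ∨ anyFin (λ u → mem u (W₁ ∪ W₂) ∧ adj G u v)
      ≡⟨ cong₂ _∨_ (mem-∪ v W₁ W₂) (trans (anyFin-cong edges) (anyFin-∨ edge₁ edge₂)) ⟩
    (mem v W₁ ∨ mem v W₂) ∨ (anyFin edge₁ ∨ anyFin edge₂)
      ≡⟨ ∨-Props.interchange (mem v W₁) (mem v W₂) (anyFin edge₁) (anyFin edge₂) ⟩
    (mem v W₁ ∨ anyFin edge₁) ∨ (mem v W₂ ∨ anyFin edge₂)
      ≡⟨ sym (cong₂ _∨_ (mem-N (sadj G¹) W₁ v) (mem-N (sadj G²) W₂ v)) ⟩
    mem v (nbhd G¹ W₁) ∨ mem v (nbhd G² W₂) ∎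
    where
    open ≡-Reasoning
    edge₁ edge₂ : Fin n → Bool
    edge₁ u = mem u W₁ ∧ sadj G¹ u v
    edge₂ u = mem u W₂ ∧ sadj G² u v
    edges : ∀ u → (mem u (W₁ ∪ W₂) ∧ adj G u v) ≡ (edge₁ u ∨ edge₂ u)
    edges u = trans (cong₂ _∧_ (mem-∪ u W₁ W₂) (edge-union u v))
                    (edge-split (mem u W₁) (mem u W₂) (mem u V₁) (mem u V₂) (mem u X)
                                (sadj G¹ u v) (sadj G² u v)
                                (split-at u) (c u) (edge-end G¹ u v) (edge-end G² u v))

  factor-identity : ∀ {W₁ W₂} → Compatible W₁ W₂ → ∀ v →
    dominationₘ (mem v W₁) (mem v W₂) (mem v (closedNbhd (adj G) (W₁ ∪ W₂))) ≡
    splittingₘ (mem v W₁) (mem v W₂) (mem v V₁) (mem v V₂) (mem v X)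
               (mem v (nbhd G¹ W₁)) (mem v (nbhd G² W₂))
  factor-identity {W₁} {W₂} c v =
    trans (cong (dominationₘ (mem v W₁) (mem v W₂)) (nbhd-union {W₁} {W₂} c v))
          (vertex-identity (mem v W₁) (mem v W₂) (mem v V₁) (mem v V₂) (mem v X)
            (mem v (nbhd G¹ W₁)) (mem v (nbhd G² W₂)) (split-at v) (c v)
            (nbhd-within G¹ W₁ (W₁⊆V₁ {W₁} {W₂} c) v) (nbhd-within G² W₂ (W₂⊆V₂ {W₁} {W₂} c) v)
            (nbhd-contains (sadj G¹) W₁ v) (nbhd-contains (sadj G²) W₂ v))

module Domination {c ℓ : Level} (R : CommutativeSemiring c ℓ) where
  open CommutativeSemiring R
    hiding (zero) renaming (refl to ≈-refl; sym to ≈-sym; trans to ≈-trans; reflexive to ≡⇒≈)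
  open Poly R
  open SetoidReasoning setoid

  ind : Bool → Carrier
  ind b = if b then 1# else 0#

  ind-∧ : ∀ a b → ind (a ∧ b) ≈ ind a * ind b
  ind-∧ true  b = ≈-sym (*-identityˡ _)
  ind-∧ false b = ≈-sym (zeroˡ _)

  ind-pair : ∀ {a b c d} → (a ∧ b) ≡ (c ∧ d) → ∀ y → ind a * (ind b * y) ≈ ind c * (ind d * y)
  ind-pair {a} {b} {c} {d} e y = begin
    ind a * (ind b * y)  ≈⟨ ≈-sym (*-assoc _ _ _) ⟩
    (ind a * ind b) * y  ≈⟨ *-congʳ (≈-sym (ind-∧ a b)) ⟩
    ind (a ∧ b) * y      ≈⟨ *-congʳ (≡⇒≈ (cong ind e)) ⟩
    ind (c ∧ d) * y      ≈⟨ *-congʳ (ind-∧ c d) ⟩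
    (ind c * ind d) * y  ≈⟨ *-assoc _ _ _ ⟩
    ind c * (ind d * y)  ∎

  Σₗ : {A : Set} → List A → (A → Carrier) → Carrier
  Σₗ L f = sumL (map f L)

  Σₗ-cong : ∀ {A : Set} (L : List A) {f g : A → Carrier} → (∀ a → f a ≈ g a) → Σₗ L f ≈ Σₗ L g
  Σₗ-cong []      h = ≈-refl
  Σₗ-cong (a ∷ L) h = +-cong (h a) (Σₗ-cong L h)

  Σₗ-zero : ∀ {A : Set} (L : List A) {f : A → Carrier} → (∀ a → f a ≈ 0#) → Σₗ L f ≈ 0#
  Σₗ-zero []      h = ≈-refl
  Σₗ-zero (a ∷ L) h = ≈-trans (+-cong (h a) (Σₗ-zero L h)) (+-identityˡ 0#)

  Σₗ-+ : ∀ {A : Set} (L : List A) (f g : A → Carrier) → Σₗ L (λ a → f a + g a) ≈ Σₗ L f + Σₗ L g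
  Σₗ-+ []      f g = ≈-sym (+-identityˡ 0#)
  Σₗ-+ (a ∷ L) f g = ≈-trans (+-congˡ (Σₗ-+ L f g)) (+-interchange _ _ _ _)
    where open CommSemigroupProps +-commutativeSemigroup renaming (interchange to +-interchange)

  Σₗ-*ˡ : ∀ {A : Set} (L : List A) k (f : A → Carrier) → k * Σₗ L f ≈ Σₗ L (λ a → k * f a)
  Σₗ-*ˡ []      k f = zeroʳ k
  Σₗ-*ˡ (a ∷ L) k f = ≈-trans (distribˡ k _ _) (+-congˡ (Σₗ-*ˡ L k f))

  Σₗ-*ʳ : ∀ {A : Set} (L : List A) k (f : A → Carrier) → Σₗ L f * k ≈ Σₗ L (λ a → f a * k)
  Σₗ-*ʳ []      k f = zeroˡ k
  Σₗ-*ʳ (a ∷ L) k f = ≈-trans (distribʳ k _ _) (+-congˡ (Σₗ-*ʳ L k f))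

  Σₗ-swap : ∀ {A B : Set} (L : List A) (M : List B) (f : A → B → Carrier) →
            Σₗ L (λ a → Σₗ M (f a)) ≈ Σₗ M (λ b → Σₗ L (λ a → f a b))
  Σₗ-swap []      M f = ≈-sym (Σₗ-zero M (λ _ → ≈-refl))
  Σₗ-swap (a ∷ L) M f = ≈-trans (+-congˡ (Σₗ-swap L M f)) (≈-sym (Σₗ-+ M (f a) _))

  Σₗ-++ : ∀ {A : Set} (L M : List A) (f : A → Carrier) → Σₗ (L ++ M) f ≈ Σₗ L f + Σₗ M f
  Σₗ-++ []      M f = ≈-sym (+-identityˡ _)
  Σₗ-++ (a ∷ L) M f = ≈-trans (+-congˡ (Σₗ-++ L M f)) (≈-sym (+-assoc _ _ _))

  Σₗ-map : ∀ {A B : Set} (L : List A) (h : A → B) (f : B → Carrier) → Σₗ (map h L) f ≡ Σₗ L (f ∘ h)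
  Σₗ-map []      h f = refl
  Σₗ-map (a ∷ L) h f = cong (f (h a) +_) (Σₗ-map L h f)

  Σₗ-concatMap : ∀ {A B : Set} (L : List A) (h : A → List B) (f : B → Carrier) →
                 Σₗ (concatMap h L) f ≈ Σₗ L (λ a → Σₗ (h a) f)
  Σₗ-concatMap []      h f = ≈-refl
  Σₗ-concatMap (a ∷ L) h f = ≈-trans (Σₗ-++ (h a) (concatMap h L) f) (+-congˡ (Σₗ-concatMap L h f))

  Σₗ-filter : ∀ {A : Set} (L : List A) (P : A → Bool) (f : A → Carrier) →
              Σₗ (filter (λ a → P a Bool.≟ true) L) f ≈ Σₗ L (λ a → ind (P a) * f a)
  Σₗ-filter []      P f = ≈-refl
  Σₗ-filter (a ∷ L) P f with P a
  ... | true  = +-cong (≈-sym (*-identityˡ _)) (Σₗ-filter L P f)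
  ... | false = ≈-trans (Σₗ-filter L P f) (≈-sym (≈-trans (+-congʳ (zeroˡ _)) (+-identityˡ _)))

  Σₛ : ∀ {n} → (Subset n → Carrier) → Carrier
  Σₛ {n} = Σₗ (allSubsets n)

  Σₛ-cong : ∀ {n} {f g : Subset n → Carrier} → (∀ A → f A ≈ g A) → Σₛ f ≈ Σₛ g
  Σₛ-cong = Σₗ-cong (allSubsets _)

  Σₛ-cong₂ : ∀ {n} {f g : Subset n → Subset n → Carrier} → (∀ A B → f A B ≈ g A B) →
             Σₛ (λ A → Σₛ (f A)) ≈ Σₛ (λ A → Σₛ (g A))
  Σₛ-cong₂ h = Σₛ-cong (λ A → Σₛ-cong (h A))

  Σₛ-*ˡ : ∀ {n} k (f : Subset n → Carrier) → k * Σₛ f ≈ Σₛ (λ A → k * f A)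
  Σₛ-*ˡ = Σₗ-*ˡ (allSubsets _)

  Σₛ-rotate : ∀ {n} (f : Subset n → Subset n → Subset n → Carrier) →
    Σₛ (λ A → Σₛ (λ B → Σₛ (λ C → f A B C))) ≈ Σₛ (λ B → Σₛ (λ C → Σₛ (λ A → f A B C)))
  Σₛ-rotate {n} f = ≈-trans (Σₗ-swap (allSubsets n) (allSubsets n) (λ A B → Σₛ (f A B)))
                            (Σₛ-cong (λ B → Σₗ-swap (allSubsets n) (allSubsets n) (λ A → f A B)))

  Σₛ-suc : ∀ {n} (f : Subset (suc n) → Carrier) →
           Σₛ f ≈ Σₛ (λ A → f (false ∷ A)) + Σₛ (λ A → f (true ∷ A))
  Σₛ-suc {n} f = ≈-trans (Σₗ-++ (map (false ∷_) (allSubsets n)) _ f)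
    (+-cong (≡⇒≈ (Σₗ-map (allSubsets n) (false ∷_) f)) (≡⇒≈ (Σₗ-map (allSubsets n) (true ∷_) f)))

  Σₛ-δ : ∀ {n} (a : Subset n) (f : Subset n → Carrier) → Σₛ (λ A → ind (a =ˢ A) * f A) ≈ f a
  Σₛ-δ []      f = ≈-trans (+-identityʳ _) (*-identityˡ _)
  Σₛ-δ {suc n} (b ∷ a) f = ≈-trans (Σₛ-suc (λ A → ind ((b ∷ a) =ˢ A) * f A)) (≈-trans (+-cong (head false) (head true)) (by-head b))
    where
    head : ∀ c → Σₛ (λ A → ind ((b ∷ a) =ˢ (c ∷ A)) * f (c ∷ A)) ≈
                 Σₛ (λ A → ind ((b == c) ∧ (a =ˢ A)) * f (c ∷ A))
    head c = Σₛ-cong (λ A → *-congʳ (≡⇒≈ (cong ind (=ˢ-cons b c a A))))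
    zero-head : ∀ c → Σₛ (λ A → ind (false ∧ (a =ˢ A)) * f (c ∷ A)) ≈ 0#
    zero-head c = Σₗ-zero (allSubsets n) (λ A → zeroˡ (f (c ∷ A)))
    by-head : ∀ b → Σₛ (λ A → ind ((b == false) ∧ (a =ˢ A)) * f (false ∷ A)) +
                    Σₛ (λ A → ind ((b == true) ∧ (a =ˢ A)) * f (true ∷ A)) ≈ f (b ∷ a)
    by-head false = ≈-trans (+-cong (Σₛ-δ a _) (zero-head true)) (+-identityʳ _)
    by-head true  = ≈-trans (+-cong (zero-head false) (Σₛ-δ a _)) (+-identityˡ _)

  Σₛ-δ₂ : ∀ {n} (a b : Subset n) (f : Subset n → Subset n → Carrier) →
          Σₛ (λ A → Σₛ (λ B → ind (a =ˢ A) * (ind (b =ˢ B) * f A B))) ≈ f a b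
  Σₛ-δ₂ {n} a b f = begin
    Σₛ (λ A → Σₛ (λ B → ind (a =ˢ A) * (ind (b =ˢ B) * f A B)))
      ≈⟨ Σₛ-cong {n} (λ A → ≈-sym (Σₛ-*ˡ (ind (a =ˢ A)) (λ B → ind (b =ˢ B) * f A B))) ⟩
    Σₛ (λ A → ind (a =ˢ A) * Σₛ (λ B → ind (b =ˢ B) * f A B))
      ≈⟨ Σₛ-cong {n} (λ A → *-congˡ (Σₛ-δ b (f A))) ⟩
    Σₛ (λ A → ind (a =ˢ A) * f A b)
      ≈⟨ Σₛ-δ a (λ A → f A b) ⟩
    f a b ∎

  Σ-RX : ∀ {n} (X : Subset n) (g : Subset n × Subset n → Carrier) →
         Σₗ (RX X) g ≈ Σₛ (λ A → Σₛ (λ B → ind (inR X (A , B)) * g (A , B)))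
  Σ-RX {n} X g = ≈-trans (Σₗ-filter pairs (inR X) g)
    (≈-trans (Σₗ-concatMap (allSubsets n) (λ A → map (A ,_) (allSubsets n)) (λ p → ind (inR X p) * g p))
             (Σₛ-cong {n} (λ A → ≡⇒≈ (Σₗ-map (allSubsets n) (A ,_) _))))
    where
    pairs : List (Subset n × Subset n)
    pairs = concatMap (λ A → map (A ,_) (allSubsets n)) (allSubsets n)

  prod-cong : ∀ {n} {f g : Fin n → Carrier} → (∀ v → f v ≈ g v) → prodFin f ≈ prodFin g
  prod-cong {zero}  h = ≈-refl
  prod-cong {suc n} h = *-cong (h fzero) (prod-cong (h ∘ fsuc))

  prod-* : ∀ {n} (f g : Fin n → Carrier) → prodFin f * prodFin g ≈ prodFin (λ v → f v * g v)
  prod-* {zero}  f g = *-identityˡ 1#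
  prod-* {suc n} f g =
    ≈-trans (*-interchange (f fzero) _ (g fzero) _) (*-congˡ (prod-* (f ∘ fsuc) (g ∘ fsuc)))
    where open CommSemigroupProps *-commutativeSemigroup renaming (interchange to *-interchange)

  prod-zero : ∀ {n} (f : Fin n → Carrier) v → f v ≈ 0# → prodFin f ≈ 0#
  prod-zero f fzero    h = ≈-trans (*-congʳ h) (zeroˡ _)
  prod-zero f (fsuc v) h = ≈-trans (*-congˡ (prod-zero (f ∘ fsuc) v h)) (zeroʳ _)

  module AtX (x : Carrier) where

    ev : Mono → Carrier
    ev 0ₘ     = 0#
    ev (x^ k) = pow x k

    pow-+ : ∀ i j → pow x (i +ℕ j) ≈ pow x i * pow x j
    pow-+ zero    j = ≈-sym (*-identityˡ _)
    pow-+ (suc i) j = ≈-trans (*-congˡ (pow-+ i j)) (≈-sym (*-assoc _ _ _))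

    ev-· : ∀ m m' → ev (m ·ₘ m') ≈ ev m * ev m'
    ev-· 0ₘ     m'     = ≈-sym (zeroˡ _)
    ev-· (x^ i) 0ₘ     = ≈-sym (zeroʳ _)
    ev-· (x^ i) (x^ j) = pow-+ i j

    ind≈ev : ∀ b → ind b ≈ ev [ b ]ₘ
    ind≈ev true  = ≈-refl
    ind≈ev false = ≈-refl

    Π-ev-· : ∀ {n} (m m' : Fin n → Mono) →
             prodFin (ev ∘ m) * prodFin (ev ∘ m') ≈ prodFin (λ v → ev (m v ·ₘ m' v))
    Π-ev-· m m' = ≈-trans (prod-* (ev ∘ m) (ev ∘ m')) (prod-cong (λ v → ≈-sym (ev-· (m v) (m' v))))

    ind-allFin : ∀ {n} (p : Fin n → Bool) → ind (allFin p) ≈ prodFin (λ v → ev [ p v ]ₘ)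
    ind-allFin {zero}  p = ≈-refl
    ind-allFin {suc n} p = ≈-trans (ind-∧ (p fzero) _) (*-cong (ind≈ev (p fzero)) (ind-allFin (p ∘ fsuc)))

    pow-card : ∀ {n} (A : Subset n) → pow x ∣ A ∣ ≈ prodFin (λ v → ev (xᵇ (mem v A)))
    pow-card []          = ≈-refl
    pow-card (true  ∷ A) = *-cong (≈-sym (*-identityʳ x)) (pow-card A)
    pow-card (false ∷ A) = ≈-trans (pow-card A) (≈-sym (*-identityˡ _))

    ev-Qᵥ : ∀ p q → ev (Qᵥₘ p q) ≈ Qv x p q
    ev-Qᵥ (false , true)  (false , true)  = ≈-refl
    ev-Qᵥ (false , true)  (false , false) = ≈-refl
    ev-Qᵥ (false , true)  (true  , _)     = ≈-refl
    ev-Qᵥ (false , false) (false , true)  = ≈-refl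
    ev-Qᵥ (false , false) (false , false) = ≈-refl
    ev-Qᵥ (false , false) (true  , _)     = ≈-refl
    ev-Qᵥ (true  , true)  (true  , true)  = *-identityʳ x
    ev-Qᵥ (true  , true)  (true  , false) = ≈-refl
    ev-Qᵥ (true  , true)  (false , _)     = ≈-refl
    ev-Qᵥ (true  , false) _               = ≈-refl

    ev-Qₘ : ∀ w₁ w₂ ξ ν₁ ν₂ →
      ev (Qₘ w₁ w₂ ξ ν₁ ν₂) ≈ (if ξ then Qv x (w₁ ∧ ξ , ν₁ ∧ ξ) (w₂ ∧ ξ , ν₂ ∧ ξ) else 1#)
    ev-Qₘ w₁ w₂ true  ν₁ ν₂ = ev-Qᵥ (w₁ ∧ true , ν₁ ∧ true) (w₂ ∧ true , ν₂ ∧ true)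
    ev-Qₘ w₁ w₂ false ν₁ ν₂ = ≈-refl

    QX-product : ∀ {n} (X W₁ N₁ W₂ N₂ : Subset n) →
      QX X x (W₁ ∩ X , N₁ ∩ X) (W₂ ∩ X , N₂ ∩ X) ≈
      prodFin (λ v → ev (Qₘ (mem v W₁) (mem v W₂) (mem v X) (mem v N₁) (mem v N₂)))
    QX-product X W₁ N₁ W₂ N₂ = prod-cong (λ v →
      ≈-sym (≈-trans (ev-Qₘ (mem v W₁) (mem v W₂) (mem v X) (mem v N₁) (mem v N₂)) (≡⇒≈ (traces v))))
      where
      traces : ∀ v →
        (if mem v X then Qv x (mem v W₁ ∧ mem v X , mem v N₁ ∧ mem v X)
                              (mem v W₂ ∧ mem v X , mem v N₂ ∧ mem v X) else 1#) ≡
        (if mem v X then Qv x (mem v (W₁ ∩ X) , mem v (N₁ ∩ X)) (mem v (W₂ ∩ X) , mem v (N₂ ∩ X)) else 1#)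
      traces v = sym (cong₂ (λ p q → if mem v X then Qv x p q else 1#)
                            (cong₂ _,_ (mem-∩ v W₁ X) (mem-∩ v N₁ X))
                            (cong₂ _,_ (mem-∩ v W₂ X) (mem-∩ v N₂ X)))

    weight : ∀ {n} {G : Graph n} → Subset n → Subgraph G → Subset n → Carrier
    weight X H W = ind (coversOutside X (verts H) (nbhd H W) W) * pow x ∣ W ─ X ∣

    weight-product : ∀ {n} {G : Graph n} (X : Subset n) (H : Subgraph G) W → weight X H W ≈
      prodFin (λ v → ev ([ coversOutsideᵥ (mem v W) (mem v (verts H)) (mem v (nbhd H W)) (mem v X) ]ₘ
                         ·ₘ xᵇ (mem v W ∧ not (mem v X))))
    weight-product X H W = ≈-trans
      (*-cong (≈-trans (≡⇒≈ (cong ind (coversOutside-pointwise X (verts H) (nbhd H W) W))) (ind-allFin covers))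
              (≈-trans (pow-card (W ─ X)) (prod-cong (λ v → ≡⇒≈ (cong (ev ∘ xᵇ) (mem-─ v W X))))))
      (Π-ev-· (λ v → [ covers v ]ₘ) (λ v → xᵇ (mem v W ∧ not (mem v X))))
      where
      covers : Fin _ → Bool
      covers v = coversOutsideᵥ (mem v W) (mem v (verts H)) (mem v (nbhd H W)) (mem v X)

    uX-expansion : ∀ {n} {G : Graph n} (X : Subset n) (H : Subgraph G) (φ : Subset n × Subset n → Carrier) →
      Σₗ (RX X) (λ p → uX X H p x * φ p) ≈ Σₛ (λ W → weight X H W * φ (signature X H W))
    uX-expansion {n} X H φ = begin
      Σₗ (RX X) (λ p → uX X H p x * φ p)
        ≈⟨ Σ-RX X (λ p → uX X H p x * φ p) ⟩
      Σₛ (λ A → Σₛ (λ B → ind (inR X (A , B)) * (uX X H (A , B) x * φ (A , B))))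
        ≈⟨ Σₛ-cong₂ {n} entry ⟩
      Σₛ (λ A → Σₛ (λ B → Σₛ (λ W → term W A B)))
        ≈⟨ ≈-sym (Σₛ-rotate term) ⟩
      Σₛ (λ W → Σₛ (λ A → Σₛ (λ B → term W A B)))
        ≈⟨ Σₛ-cong {n} (λ W → Σₛ-δ₂ (W ∩ X) (nbhd H W ∩ X) (λ A B → weight X H W * φ (A , B))) ⟩
      Σₛ (λ W → weight X H W * φ (signature X H W)) ∎
      where
      term : Subset n → Subset n → Subset n → Carrier
      term W A B = ind ((W ∩ X) =ˢ A) * (ind ((nbhd H W ∩ X) =ˢ B) * (weight X H W * φ (A , B)))

      wt : Subset n → Carrier
      wt W = pow x ∣ W ─ X ∣

      regroup : ∀ A B W → ind (inR X (A , B)) * ((ind (selects X H (A , B) W) * wt W) * φ (A , B)) ≈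
                          term W A B
      regroup A B W = begin
        ind r * ((ind s * wt W) * f)        ≈⟨ *-congˡ (*-assoc _ _ _) ⟩
        ind r * (ind s * (wt W * f))        ≈⟨ ≈-sym (*-assoc _ _ _) ⟩
        (ind r * ind s) * (wt W * f)        ≈⟨ *-congʳ (≈-sym (ind-∧ r s)) ⟩
        ind (r ∧ s) * (wt W * f)            ≈⟨ *-congʳ (≡⇒≈ (cong ind (selects-inR X H A B W))) ⟩
        ind (a ∧ (b ∧ cov)) * (wt W * f)    ≈⟨ *-congʳ (≈-trans (ind-∧ a _) (*-congˡ (ind-∧ b cov))) ⟩
        (ind a * (ind b * ind cov)) * (wt W * f)  ≈⟨ *-assoc _ _ _ ⟩
        ind a * ((ind b * ind cov) * (wt W * f))  ≈⟨ *-congˡ (*-assoc _ _ _) ⟩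
        ind a * (ind b * (ind cov * (wt W * f)))  ≈⟨ *-congˡ (*-congˡ (≈-sym (*-assoc _ _ _))) ⟩
        term W A B ∎
        where
        r = inR X (A , B)
        s = selects X H (A , B) W
        a = (W ∩ X) =ˢ A
        b = (nbhd H W ∩ X) =ˢ B
        cov = coversOutside X (verts H) (nbhd H W) W
        f = φ (A , B)

      entry : ∀ A B → ind (inR X (A , B)) * (uX X H (A , B) x * φ (A , B)) ≈ Σₛ (λ W → term W A B)
      entry A B = begin
        ind r * (uX X H (A , B) x * φ (A , B))
          ≈⟨ *-congˡ (*-congʳ (Σₗ-filter (allSubsets n) (selects X H (A , B)) wt)) ⟩
        ind r * (Σₛ (λ W → ind (selects X H (A , B) W) * wt W) * φ (A , B))
          ≈⟨ *-congˡ (Σₗ-*ʳ (allSubsets n) (φ (A , B)) (λ W → ind (selects X H (A , B) W) * wt W)) ⟩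
        ind r * Σₛ (λ W → (ind (selects X H (A , B) W) * wt W) * φ (A , B))
          ≈⟨ Σₛ-*ˡ (ind r) (λ W → (ind (selects X H (A , B) W) * wt W) * φ (A , B)) ⟩
        Σₛ (λ W → ind r * ((ind (selects X H (A , B) W) * wt W) * φ (A , B)))
          ≈⟨ Σₛ-cong {n} (regroup A B) ⟩
        Σₛ (λ W → term W A B) ∎
        where
        r = inR X (A , B)

    bilinear-expansion : ∀ {n} {G : Graph n} (X : Subset n) (H₁ H₂ : Subgraph G)
      (M : Subset n × Subset n → Subset n × Subset n → Carrier) →
      bilinear X (λ p → uX X H₁ p x) M (λ q → uX X H₂ q x) ≈
      Σₛ (λ W₁ → Σₛ (λ W₂ → weight X H₁ W₁ * (weight X H₂ W₂ * M (signature X H₁ W₁) (signature X H₂ W₂))))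
    bilinear-expansion {n} X H₁ H₂ M = begin
      Σₗ (RX X) (λ p → Σₗ (RX X) (λ q → u₁ p * (M p q * u₂ q)))
        ≈⟨ Σₗ-cong (RX X) inner ⟩
      Σₗ (RX X) (λ p → u₁ p * Σₛ (λ W₂ → weight X H₂ W₂ * M p (σ₂ W₂)))
        ≈⟨ uX-expansion X H₁ (λ p → Σₛ (λ W₂ → weight X H₂ W₂ * M p (σ₂ W₂))) ⟩
      Σₛ (λ W₁ → weight X H₁ W₁ * Σₛ (λ W₂ → weight X H₂ W₂ * M (σ₁ W₁) (σ₂ W₂)))
        ≈⟨ Σₛ-cong {n} (λ W₁ → Σₛ-*ˡ (weight X H₁ W₁) (λ W₂ → weight X H₂ W₂ * M (σ₁ W₁) (σ₂ W₂))) ⟩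
      Σₛ (λ W₁ → Σₛ (λ W₂ → weight X H₁ W₁ * (weight X H₂ W₂ * M (σ₁ W₁) (σ₂ W₂)))) ∎
      where
      u₁ u₂ : Subset n × Subset n → Carrier
      u₁ p = uX X H₁ p x
      u₂ q = uX X H₂ q x
      σ₁ σ₂ : Subset n → Subset n × Subset n
      σ₁ = signature X H₁
      σ₂ = signature X H₂
      inner : ∀ p → Σₗ (RX X) (λ q → u₁ p * (M p q * u₂ q)) ≈
                    u₁ p * Σₛ (λ W₂ → weight X H₂ W₂ * M p (σ₂ W₂))
      inner p = begin
        Σₗ (RX X) (λ q → u₁ p * (M p q * u₂ q))
          ≈⟨ Σₗ-cong (RX X) (λ q → *-congˡ (*-comm (M p q) (u₂ q))) ⟩
        Σₗ (RX X) (λ q → u₁ p * (u₂ q * M p q))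
          ≈⟨ ≈-sym (Σₗ-*ˡ (RX X) (u₁ p) (λ q → u₂ q * M p q)) ⟩
        u₁ p * Σₗ (RX X) (λ q → u₂ q * M p q)
          ≈⟨ *-congˡ (uX-expansion X H₂ (M p)) ⟩
        u₁ p * Σₛ (λ W₂ → weight X H₂ W₂ * M p (σ₂ W₂)) ∎

    module SplittingFormula {n : ℕ} {G : Graph n} {G¹ G² : Subgraph G} {X : Subset n}
                            (sp : IsSplitting G G¹ G² X) where
      open Splitting sp

      N : Subset n → Subset n
      N = closedNbhd (adj G)

      dominating : Subset n → Carrier
      dominating W = ind (N W =ˢ ⊤) * pow x ∣ W ∣

      D-as-sum : D G x ≈ Σₛ dominating
      D-as-sum = Σₗ-filter (allSubsets n) (λ W → N W =ˢ ⊤) (λ W → pow x ∣ W ∣)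

      reindex : ∀ (f : Subset n → Carrier) →
        Σₛ f ≈ Σₛ (λ W₁ → Σₛ (λ W₂ → ind (compatible V₁ V₂ X W₁ W₂) * f (W₁ ∪ W₂)))
      reindex f = begin
        Σₛ f
          ≈⟨ Σₛ-cong {n} (λ W → ≈-sym (Σₛ-δ₂ (W ∩ V₁) (W ∩ V₂) (λ _ _ → f W))) ⟩
        Σₛ (λ W → Σₛ (λ W₁ → Σₛ (λ W₂ → traces W W₁ W₂)))
          ≈⟨ Σₛ-rotate traces ⟩
        Σₛ (λ W₁ → Σₛ (λ W₂ → Σₛ (λ W → traces W W₁ W₂)))
          ≈⟨ Σₛ-cong₂ {n} (λ W₁ W₂ → Σₛ-cong {n} (λ W → ind-pair (reindex-bool W W₁ W₂) (f W))) ⟩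
        Σₛ (λ W₁ → Σₛ (λ W₂ → Σₛ (λ W → ind ((W₁ ∪ W₂) =ˢ W) * (ind (compatible V₁ V₂ X W₁ W₂) * f W))))
          ≈⟨ Σₛ-cong₂ {n} (λ W₁ W₂ → Σₛ-δ (W₁ ∪ W₂) (λ W → ind (compatible V₁ V₂ X W₁ W₂) * f W)) ⟩
        Σₛ (λ W₁ → Σₛ (λ W₂ → ind (compatible V₁ V₂ X W₁ W₂) * f (W₁ ∪ W₂))) ∎
        where
        traces : Subset n → Subset n → Subset n → Carrier
        traces W W₁ W₂ = ind ((W ∩ V₁) =ˢ W₁) * (ind ((W ∩ V₂) =ˢ W₂) * f W)

      splitSummand : Subset n → Subset n → Carrier
      splitSummand W₁ W₂ =
        weight X G¹ W₁ * (weight X G² W₂ * QX X x (signature X G¹ W₁) (signature X G² W₂))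

      dominating-product : ∀ W₁ W₂ → dominating (W₁ ∪ W₂) ≈
        prodFin (λ v → ev (dominationₘ (mem v W₁) (mem v W₂) (mem v (N (W₁ ∪ W₂)))))
      dominating-product W₁ W₂ = ≈-trans
        (*-cong (≈-trans (≡⇒≈ (cong ind (=ˢ⊤-pointwise (N (W₁ ∪ W₂))))) (ind-allFin (λ v → mem v (N (W₁ ∪ W₂)))))
                (≈-trans (pow-card (W₁ ∪ W₂)) (prod-cong (λ v → ≡⇒≈ (cong (ev ∘ xᵇ) (mem-∪ v W₁ W₂))))))
        (Π-ev-· (λ v → [ mem v (N (W₁ ∪ W₂)) ]ₘ) (λ v → xᵇ (mem v W₁ ∨ mem v W₂)))

      splitSummand-product : ∀ W₁ W₂ → splitSummand W₁ W₂ ≈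
        prodFin (λ v → ev (splittingₘ (mem v W₁) (mem v W₂) (mem v V₁) (mem v V₂) (mem v X)
                                      (mem v (nbhd G¹ W₁)) (mem v (nbhd G² W₂))))
      splitSummand-product W₁ W₂ = ≈-trans
        (*-cong (weight-product X G¹ W₁)
                (≈-trans (*-cong (weight-product X G² W₂) (QX-product X W₁ (nbhd G¹ W₁) W₂ (nbhd G² W₂)))
                         (Π-ev-· factor₂ qfactor)))
        (Π-ev-· factor₁ (λ v → factor₂ v ·ₘ qfactor v))
        where
        factor₁ factor₂ qfactor : Fin n → Mono
        factor₁ v = [ coversOutsideᵥ (mem v W₁) (mem v V₁) (mem v (nbhd G¹ W₁)) (mem v X) ]ₘ
                    ·ₘ xᵇ (mem v W₁ ∧ not (mem v X))
        factor₂ v = [ coversOutsideᵥ (mem v W₂) (mem v V₂) (mem v (nbhd G² W₂)) (mem v X) ]ₘ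
                    ·ₘ xᵇ (mem v W₂ ∧ not (mem v X))
        qfactor v = Qₘ (mem v W₁) (mem v W₂) (mem v X) (mem v (nbhd G¹ W₁)) (mem v (nbhd G² W₂))

      summand-identity : ∀ W₁ W₂ →
        ind (compatible V₁ V₂ X W₁ W₂) * dominating (W₁ ∪ W₂) ≈ splitSummand W₁ W₂
      summand-identity W₁ W₂ with compatible V₁ V₂ X W₁ W₂ in eq
      ... | true = begin
        1# * dominating (W₁ ∪ W₂)
          ≈⟨ *-identityˡ _ ⟩
        dominating (W₁ ∪ W₂)
          ≈⟨ dominating-product W₁ W₂ ⟩
        prodFin (λ v → ev (dominationₘ (mem v W₁) (mem v W₂) (mem v (N (W₁ ∪ W₂)))))
          ≈⟨ prod-cong (λ v → ≡⇒≈ (cong ev (factor-identity {W₁} {W₂} compat v))) ⟩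
        prodFin (λ v → ev (splittingₘ (mem v W₁) (mem v W₂) (mem v V₁) (mem v V₂) (mem v X)
                                      (mem v (nbhd G¹ W₁)) (mem v (nbhd G² W₂))))
          ≈⟨ ≈-sym (splitSummand-product W₁ W₂) ⟩
        splitSummand W₁ W₂ ∎
        where
        compat : Compatible W₁ W₂
        compat = allFin-elim _ (trans (sym (compatible-pointwise V₁ V₂ X W₁ W₂)) eq)
      ... | false with allFin-false _ (trans (sym (compatible-pointwise V₁ V₂ X W₁ W₂)) eq)
      ...   | v , incompatible = ≈-trans (zeroˡ _) (≈-sym (≈-trans (splitSummand-product W₁ W₂)
                (prod-zero _ v (≡⇒≈ (cong ev (vertex-zero (mem v W₁) (mem v W₂) (mem v V₁) (mem v V₂) (mem v X)
                                                          (mem v (nbhd G¹ W₁)) (mem v (nbhd G² W₂)) incompatible))))))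

mainTheorem11 : ∀ {c ℓ : Level} (R : CommutativeSemiring c ℓ) {n : ℕ}
    (G : Graph n) (G¹ G² : Subgraph G) (X : Subset n) → IsSplitting G G¹ G² X →
    (x : CommutativeSemiring.Carrier R) →
    CommutativeSemiring._≈_ R (Poly.D R G x)
      (Poly.bilinear R X (λ p → Poly.uX R X G¹ p x) (Poly.QX R X x) (λ q → Poly.uX R X G² q x))
mainTheorem11 R G G¹ G² X sp x = begin
  D G x
    ≈⟨ D-as-sum ⟩
  Σₛ dominating
    ≈⟨ reindex dominating ⟩
  Σₛ (λ W₁ → Σₛ (λ W₂ → ind (compatible V₁ V₂ X W₁ W₂) * dominating (W₁ ∪ W₂)))
    ≈⟨ Σₛ-cong₂ summand-identity ⟩
  Σₛ (λ W₁ → Σₛ (λ W₂ → splitSummand W₁ W₂))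
    ≈⟨ ≈-sym (bilinear-expansion X G¹ G² (QX X x)) ⟩
  bilinear X (λ p → uX X G¹ p x) (QX X x) (λ q → uX X G² q x) ∎
  where
  open CommutativeSemiring R using (_*_; setoid) renaming (sym to ≈-sym)
  open SetoidReasoning setoid
  open Poly R
  open Domination R
  open AtX x
  open Splitting sp using (V₁; V₂)
  open SplittingFormula sp
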